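{- Let $G$ be a group with a prefiltration $(G_i)_{i\ge0}$, and let $H,K$ be subgroups of $G$ with prefiltrations $(H_i)_{i\ge0}$, $(K_i)_{i\ge0}$ satisfying $H_i\subset G_i$, $K_i\subset G_i$, and such that $G_i\subset H_iK_i=\{ab:a\in H_i,b\in K_i\}$ for all $i\ge0$. Then $\mathrm{HK}^k(G)\subset\mathrm{HK}^k(H)\,\mathrm{HK}^k(K)$ for all $k\ge0$.
   Context: A prefiltration on a group $G$ is a sequence of subgroups $G_0\ge G_1\ge\dots$ with $[G_i,G_j]\subset G_{i+j}$ for all $i,j$. For $k\ge0$, the Host–Kra group $\mathrm{HK}^k(G)$ is the subgroup of $G^{\{0,1\}^k}$ generated by the elements $(g^{1_{\omega\ge\omega_0}})_{\omega\in\{0,1\}^k}$ for $\omega_0\in\{0,1\}^k$ and $g\in G_{|\omega_0|}$, where $\omega\ge\omega_0$ is the product order, $|\omega_0|$ is the number of ones, and $g^{1_{\omega\ge\omega_0}}$ is $g$ if $\omega\ge\omega_0$ and the identity otherwise. Products of sets $AB=\{ab:a\in A,b\in B\}$. -}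

module Defs where

open import Level using (Level; _⊔_; suc)
open import Data.Nat using (ℕ; zero; _+_) renaming (suc to sucℕ)
open import Data.Bool using (Bool; true; false; if_then_else_; _∧_; not; _∨_)
open import Data.Vec using (Vec; []; _∷_)
open import Data.Product using (Σ; _×_; ∃)
open import Relation.Unary using (Pred; _⊆_)
open import Algebra.Bundles using (Group)

Cube : ℕ → Set
Cube k = Vec Bool k

weight : ∀ {k} → Cube k → ℕ
weight []            = 0
weight (true  ∷ ω)   = sucℕ (weight ω)
weight (false ∷ ω)   = weight ω

_≤ᵇ_ : ∀ {k} → Cube k → Cube k → Bool
[]       ≤ᵇ []       = true
(a ∷ ω₀) ≤ᵇ (b ∷ ω)  = (not a ∨ b) ∧ (ω₀ ≤ᵇ ω)

module _ {c ℓ : Level} (G : Group c ℓ) where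
  open Group G

  record IsSubgroup {p : Level} (S : Pred Carrier p) : Set (c ⊔ ℓ ⊔ p) where
    field
      resp  : ∀ {x y} → x ≈ y → S x → S y
      ε∈    : S ε
      ∙∈    : ∀ {x y} → S x → S y → S (x ∙ y)
      ⁻¹∈   : ∀ {x} → S x → S (x ⁻¹)

  [_,_] : Carrier → Carrier → Carrier
  [ x , y ] = ((x ⁻¹ ∙ y ⁻¹) ∙ x) ∙ y

  record IsPrefiltration {p : Level} (F : ℕ → Pred Carrier p) : Set (c ⊔ ℓ ⊔ p) where
    field
      subgroup   : ∀ i → IsSubgroup (F i)
      decreasing : ∀ i → F (sucℕ i) ⊆ F i
      commutator : ∀ i j {x y} → F i x → F j y → F (i + j) [ x , y ]

  CubeElt : ℕ → Set c
  CubeElt k = Cube k → Carrier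

  face : ∀ {k} → Cube k → Carrier → CubeElt k
  face ω₀ g ω = if ω₀ ≤ᵇ ω then g else ε

  -- The Host–Kra group HK^k(F): the subgroup of G^{{0,1}^k} (pointwise
  -- operations, pointwise equality) generated by face ω₀ g with g ∈ F_{|ω₀|}.
  data HK {p : Level} (F : ℕ → Pred Carrier p) (k : ℕ) : Pred (CubeElt k) (c ⊔ ℓ ⊔ p) where
    gen  : ∀ (ω₀ : Cube k) {g} → F (weight ω₀) g → HK F k (face ω₀ g)
    one  : HK F k (λ _ → ε)
    mul  : ∀ {x y} → HK F k x → HK F k y → HK F k (λ ω → x ω ∙ y ω)
    inv  : ∀ {x} → HK F k x → HK F k (λ ω → x ω ⁻¹)
    resp : ∀ {x y} → (∀ ω → x ω ≈ y ω) → HK F k x → HK F k y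

-- Split a cube of {0,1}^(k+1) along its first coordinate into a lower and an upper face:
-- z ∈ HK^(k+1)(F) iff its lower face x lies in HK^k(F) and x⁻¹·(upper face) lies in HK^k(F⁺),
-- where F⁺ i = F (i + 1).  Both directions rest on HK^k(F) normalising HK^k(F⁺), which on
-- generators is the commutator condition of the prefiltration.
-- Now induct on k, simultaneously for (G, H, K) and all its shifts.  Write x = h κ and
-- x⁻¹·(upper face) = h′ κ′, so the upper face is h·(κ h′ κ⁻¹)·κ κ′.  Factor κ h′ κ⁻¹ ∈ HK^k(G⁺)
-- once more as h̃ κ̃ and move κ̃ to the right of κ, which keeps it in HK^k(K⁺) by normality.
module Submission where

open import Defs
open import Level using (Level; _⊔_)
open import Function using (_∘_; id)
open import Data.Nat using (ℕ; zero; suc; _+_; _≤_; _≤′_; s≤s; z≤n; ≤′-refl; ≤′-step)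
open import Data.Nat.Properties using (+-suc; +-monoʳ-≤; n≤1+n; m≤n⇒m≤1+n; ≤⇒≤′)
open import Data.Bool using (true; false; _∧_; not; _∨_)
open import Data.Bool.Properties using (∧-idem; ∧-identityʳ; ∧-commutativeMonoid)
open import Data.Vec using ([]; _∷_; zipWith)
open import Data.Product using (Σ; _×_; _,_; proj₁; proj₂)
open import Relation.Unary using (Pred; _⊆_)
open import Relation.Binary.Definitions using (_Respects_)
open import Relation.Binary.PropositionalEquality using (_≡_)
import Relation.Binary.PropositionalEquality as ≡
open import Algebra.Bundles using (Group; CommutativeMonoid)
open import Algebra.Morphism.Structures using (module GroupMorphisms)
open import Algebra.Properties.CommutativeSemigroup (CommutativeMonoid.commutativeSemigroup ∧-commutativeMonoid)
  using (interchange)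
import Algebra.Construct.Pointwise as Pointwise
import Algebra.Properties.Group as GroupProperties

_∨ᶜ_ : ∀ {k} → Cube k → Cube k → Cube k
_∨ᶜ_ = zipWith _∨_

∨-⇒-distrib : ∀ a b d → (not (a ∨ b) ∨ d) ≡ (not a ∨ d) ∧ (not b ∨ d)
∨-⇒-distrib true  true  d = ≡.sym (∧-idem d)
∨-⇒-distrib true  false d = ≡.sym (∧-identityʳ d)
∨-⇒-distrib false true  d = ≡.refl
∨-⇒-distrib false false d = ≡.refl

≤ᵇ-∨ᶜ : ∀ {k} (u v w : Cube k) → (u ∨ᶜ v) ≤ᵇ w ≡ (u ≤ᵇ w) ∧ (v ≤ᵇ w)
≤ᵇ-∨ᶜ []      []      []      = ≡.refl
≤ᵇ-∨ᶜ (a ∷ u) (b ∷ v) (d ∷ w) = begin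
  (not (a ∨ b) ∨ d) ∧ ((u ∨ᶜ v) ≤ᵇ w)
    ≡⟨ ≡.cong₂ _∧_ (∨-⇒-distrib a b d) (≤ᵇ-∨ᶜ u v w) ⟩
  ((not a ∨ d) ∧ (not b ∨ d)) ∧ ((u ≤ᵇ w) ∧ (v ≤ᵇ w))
    ≡⟨ interchange (not a ∨ d) (not b ∨ d) (u ≤ᵇ w) (v ≤ᵇ w) ⟩
  ((not a ∨ d) ∧ (u ≤ᵇ w)) ∧ ((not b ∨ d) ∧ (v ≤ᵇ w)) ∎
  where open ≡.≡-Reasoning

weight-∨ᶜ : ∀ {k} (u v : Cube k) → weight (u ∨ᶜ v) ≤ weight u + weight v
weight-∨ᶜ []          []          = z≤n
weight-∨ᶜ (true ∷ u)  (true ∷ v)  rewrite +-suc (weight u) (weight v) = s≤s (m≤n⇒m≤1+n (weight-∨ᶜ u v))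
weight-∨ᶜ (true ∷ u)  (false ∷ v) = s≤s (weight-∨ᶜ u v)
weight-∨ᶜ (false ∷ u) (true ∷ v)  rewrite +-suc (weight u) (weight v) = s≤s (weight-∨ᶜ u v)
weight-∨ᶜ (false ∷ u) (false ∷ v) = weight-∨ᶜ u v

module _ {c₁ ℓ₁ c₂ ℓ₂ : Level} {G₁ : Group c₁ ℓ₁} {G₂ : Group c₂ ℓ₂} where
  open GroupMorphisms (Group.rawGroup G₁) (Group.rawGroup G₂)
  private
    module G₁ = Group G₁
    module G₂ = Group G₂
  open GroupProperties G₂ using (identityˡ-unique; inverseˡ-unique)
  open import Relation.Binary.Reasoning.Setoid G₂.setoid

  ∙-homo⇒isGroupHomomorphism : ∀ {f : G₁.Carrier → G₂.Carrier} →
    (∀ {x y} → x G₁.≈ y → f x G₂.≈ f y) → (∀ x y → f (x G₁.∙ y) G₂.≈ f x G₂.∙ f y) →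
    IsGroupHomomorphism f
  ∙-homo⇒isGroupHomomorphism {f} f-cong f-homo = record
    { isMonoidHomomorphism = record
      { isMagmaHomomorphism = record { isRelHomomorphism = record { cong = f-cong } ; homo = f-homo }
      ; ε-homo = ε-homo
      }
    ; ⁻¹-homo = λ x → inverseˡ-unique (f (x G₁.⁻¹)) (f x) (begin
        f (x G₁.⁻¹) G₂.∙ f x  ≈⟨ f-homo (x G₁.⁻¹) x ⟨
        f (x G₁.⁻¹ G₁.∙ x)    ≈⟨ f-cong (G₁.inverseˡ x) ⟩
        f G₁.ε                ≈⟨ ε-homo ⟩
        G₂.ε                  ∎)
    }
    where
    ε-homo : f G₁.ε G₂.≈ G₂.ε
    ε-homo = identityˡ-unique (f G₁.ε) (f G₁.ε) (begin
      f G₁.ε G₂.∙ f G₁.ε  ≈⟨ f-homo G₁.ε G₁.ε ⟨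
      f (G₁.ε G₁.∙ G₁.ε)  ≈⟨ f-cong (G₁.identityˡ G₁.ε) ⟩
      f G₁.ε              ∎)

  preimage-isSubgroup : ∀ {f p} {S : Pred G₂.Carrier p} →
    IsGroupHomomorphism f → IsSubgroup G₂ S → IsSubgroup G₁ (S ∘ f)
  preimage-isSubgroup f-homo S-subgroup = record
    { resp = λ x≈y → S.resp (⟦⟧-cong x≈y)
    ; ε∈   = S.resp (G₂.sym ε-homo) S.ε∈
    ; ∙∈   = λ fx fy → S.resp (G₂.sym (homo _ _)) (S.∙∈ fx fy)
    ; ⁻¹∈  = λ fx → S.resp (G₂.sym (⁻¹-homo _)) (S.⁻¹∈ fx)
    }
    where
    open IsGroupHomomorphism f-homo
    module S = IsSubgroup S-subgroup

module GroupTheory {c ℓ : Level} (G : Group c ℓ) where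
  open Group G
  open GroupProperties G
  open GroupMorphisms rawGroup rawGroup using (IsGroupHomomorphism)
  open import Relation.Binary.Reasoning.Setoid setoid

  conj : Carrier → Carrier → Carrier
  conj a u = (a ∙ u) // a

  _·_ : ∀ {p q} → Pred Carrier p → Pred Carrier q → Pred Carrier (c ⊔ ℓ ⊔ p ⊔ q)
  (A · B) g = Σ Carrier λ a → Σ Carrier λ b → A a × B b × g ≈ a ∙ b

  Normalises : ∀ {p} → Pred Carrier p → Pred Carrier (c ⊔ p)
  Normalises N a = (∀ {u} → N u → N (conj a u)) × (∀ {u} → N u → N (conj (a ⁻¹) u))

  conj-cong : ∀ {a a' u u'} → a ≈ a' → u ≈ u' → conj a u ≈ conj a' u'
  conj-cong a≈a' u≈u' = //-cong₂ (∙-cong a≈a' u≈u') a≈a'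

  conj-identityˡ : ∀ u → conj ε u ≈ u
  conj-identityˡ u = trans (∙-cong (identityˡ u) ε⁻¹≈ε) (identityʳ u)

  conj-ε : ∀ a → conj a ε ≈ ε
  conj-ε a = trans (∙-congʳ (identityʳ a)) (inverseʳ a)

  ∙≈conj∙ : ∀ a u → a ∙ u ≈ conj a u ∙ a
  ∙≈conj∙ a u = sym (//-rightDividesˡ a (a ∙ u))

  ∙≈∙conj⁻¹ : ∀ a u → u ∙ a ≈ a ∙ conj (a ⁻¹) u
  ∙≈∙conj⁻¹ a u = begin
    u ∙ a                       ≈⟨ ∙-cong (\\-leftDividesˡ a u) (⁻¹-involutive a) ⟨
    (a ∙ (a ⁻¹ ∙ u)) ∙ a ⁻¹ ⁻¹  ≈⟨ assoc a _ _ ⟩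
    a ∙ conj (a ⁻¹) u           ∎

  conj-∙ : ∀ a u v → conj a (u ∙ v) ≈ conj a u ∙ conj a v
  conj-∙ a u v = begin
    (a ∙ (u ∙ v)) ∙ a ⁻¹         ≈⟨ ∙-congʳ (assoc a u v) ⟨
    ((a ∙ u) ∙ v) ∙ a ⁻¹         ≈⟨ ∙-congʳ (∙-congʳ (∙≈conj∙ a u)) ⟩
    ((conj a u ∙ a) ∙ v) ∙ a ⁻¹  ≈⟨ ∙-congʳ (assoc _ a v) ⟩
    (conj a u ∙ (a ∙ v)) ∙ a ⁻¹  ≈⟨ assoc _ _ _ ⟩
    conj a u ∙ conj a v          ∎

  conj-isGroupHomomorphism : ∀ a → IsGroupHomomorphism (conj a)
  conj-isGroupHomomorphism a = ∙-homo⇒isGroupHomomorphism {G₁ = G} {G₂ = G} (conj-cong refl) (conj-∙ a)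

  conj-conj : ∀ a b u → conj (a ∙ b) u ≈ conj a (conj b u)
  conj-conj a b u = begin
    ((a ∙ b) ∙ u) ∙ (a ∙ b) ⁻¹     ≈⟨ ∙-cong (assoc a b u) (⁻¹-anti-homo-∙ a b) ⟩
    (a ∙ (b ∙ u)) ∙ (b ⁻¹ ∙ a ⁻¹)  ≈⟨ assoc _ _ _ ⟨
    ((a ∙ (b ∙ u)) ∙ b ⁻¹) ∙ a ⁻¹  ≈⟨ ∙-congʳ (assoc _ _ _) ⟩
    (a ∙ conj b u) ∙ a ⁻¹          ∎

  conj≈∙commutator : ∀ a u → conj a u ≈ u ∙ [_,_] G u (a ⁻¹)
  conj≈∙commutator a u = begin
    (a ∙ u) ∙ a ⁻¹                        ≈⟨ ∙-congʳ (∙-congʳ (⁻¹-involutive a)) ⟨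
    (a ⁻¹ ⁻¹ ∙ u) ∙ a ⁻¹                  ≈⟨ ∙-congʳ (\\-leftDividesˡ u _) ⟨
    (u ∙ (u ⁻¹ ∙ (a ⁻¹ ⁻¹ ∙ u))) ∙ a ⁻¹  ≈⟨ ∙-congʳ (∙-congˡ (assoc _ _ _)) ⟨
    (u ∙ ((u ⁻¹ ∙ a ⁻¹ ⁻¹) ∙ u)) ∙ a ⁻¹  ≈⟨ assoc _ _ _ ⟩
    u ∙ [_,_] G u (a ⁻¹)                  ∎

  \\-∙-conj : ∀ x x' y y' → (x ∙ x') \\ (y ∙ y') ≈ conj (x' ⁻¹) (x \\ y) ∙ (x' \\ y')
  \\-∙-conj x x' y y' = begin
    (x ∙ x') ⁻¹ ∙ (y ∙ y')                  ≈⟨ ∙-congʳ (⁻¹-anti-homo-∙ x x') ⟩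
    (x' ⁻¹ ∙ x ⁻¹) ∙ (y ∙ y')               ≈⟨ assoc _ _ _ ⟩
    x' ⁻¹ ∙ (x ⁻¹ ∙ (y ∙ y'))               ≈⟨ ∙-congˡ (assoc _ _ _) ⟨
    x' ⁻¹ ∙ ((x \\ y) ∙ y')                 ≈⟨ assoc _ _ _ ⟨
    (x' ⁻¹ ∙ (x \\ y)) ∙ y'                 ≈⟨ ∙-congʳ (∙≈conj∙ (x' ⁻¹) _) ⟩
    (conj (x' ⁻¹) (x \\ y) ∙ x' ⁻¹) ∙ y'   ≈⟨ assoc _ _ _ ⟩
    conj (x' ⁻¹) (x \\ y) ∙ (x' \\ y')      ∎

  \\-⁻¹-conj : ∀ x y → x ⁻¹ \\ y ⁻¹ ≈ conj x ((x \\ y) ⁻¹)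
  \\-⁻¹-conj x y = begin
    x ⁻¹ ⁻¹ ∙ y ⁻¹           ≈⟨ ∙-congʳ (⁻¹-involutive x) ⟩
    x ∙ y ⁻¹                 ≈⟨ //-rightDividesʳ x (x ∙ y ⁻¹) ⟨
    ((x ∙ y ⁻¹) ∙ x) ∙ x ⁻¹  ≈⟨ ∙-congʳ (assoc _ _ _) ⟩
    (x ∙ (y ⁻¹ ∙ x)) ∙ x ⁻¹  ≈⟨ conj-cong refl (∙-congˡ (⁻¹-involutive x)) ⟨
    conj x (y ⁻¹ ∙ x ⁻¹ ⁻¹)  ≈⟨ conj-cong refl (⁻¹-anti-homo-∙ (x ⁻¹) y) ⟨
    conj x ((x \\ y) ⁻¹)     ∎

  ∙-refactor : ∀ {x y h κ h′ κ′ h̃ κ̃} → x ≈ h ∙ κ → x \\ y ≈ h′ ∙ κ′ → conj κ h′ ≈ h̃ ∙ κ̃ →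
    y ≈ (h ∙ h̃) ∙ (κ ∙ (conj (κ ⁻¹) κ̃ ∙ κ′))
  ∙-refactor {x} {y} {h} {κ} {h′} {κ′} {h̃} {κ̃} x≈hκ x\\y≈h′κ′ κh′κ⁻¹≈h̃κ̃ = begin
    y                                        ≈⟨ \\-leftDividesˡ x y ⟨
    x ∙ (x \\ y)                             ≈⟨ ∙-cong x≈hκ x\\y≈h′κ′ ⟩
    (h ∙ κ) ∙ (h′ ∙ κ′)                      ≈⟨ assoc h κ _ ⟩
    h ∙ (κ ∙ (h′ ∙ κ′))                      ≈⟨ ∙-congˡ (assoc κ h′ κ′) ⟨
    h ∙ ((κ ∙ h′) ∙ κ′)                      ≈⟨ ∙-congˡ (∙-congʳ (∙≈conj∙ κ h′)) ⟩
    h ∙ ((conj κ h′ ∙ κ) ∙ κ′)               ≈⟨ ∙-congˡ (∙-congʳ (∙-congʳ κh′κ⁻¹≈h̃κ̃)) ⟩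
    h ∙ (((h̃ ∙ κ̃) ∙ κ) ∙ κ′)                 ≈⟨ ∙-congˡ (∙-congʳ (assoc h̃ κ̃ κ)) ⟩
    h ∙ ((h̃ ∙ (κ̃ ∙ κ)) ∙ κ′)                 ≈⟨ ∙-congˡ (∙-congʳ (∙-congˡ (∙≈∙conj⁻¹ κ κ̃))) ⟩
    h ∙ ((h̃ ∙ (κ ∙ conj (κ ⁻¹) κ̃)) ∙ κ′)     ≈⟨ ∙-congˡ (assoc h̃ _ κ′) ⟩
    h ∙ (h̃ ∙ ((κ ∙ conj (κ ⁻¹) κ̃) ∙ κ′))     ≈⟨ assoc h h̃ _ ⟨
    (h ∙ h̃) ∙ ((κ ∙ conj (κ ⁻¹) κ̃) ∙ κ′)     ≈⟨ ∙-congˡ (assoc κ _ κ′) ⟩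
    (h ∙ h̃) ∙ (κ ∙ (conj (κ ⁻¹) κ̃ ∙ κ′))     ∎

  normaliser-isSubgroup : ∀ {p} {N : Pred Carrier p} → N Respects _≈_ → IsSubgroup G (Normalises N)
  normaliser-isSubgroup {N = N} N-resp = record
    { resp = λ a≈b (by-a , by-a⁻¹) →
        (N-resp (conj-cong a≈b refl) ∘ by-a) , (N-resp (conj-cong (⁻¹-cong a≈b) refl) ∘ by-a⁻¹)
    ; ε∈   = N-resp (sym (conj-identityˡ _))
           , N-resp (sym (trans (conj-cong ε⁻¹≈ε refl) (conj-identityˡ _)))
    ; ∙∈   = λ { {a} {b} (by-a , by-a⁻¹) (by-b , by-b⁻¹) →
          N-resp (sym (conj-conj a b _)) ∘ by-a ∘ by-b
        , N-resp (sym (trans (conj-cong (⁻¹-anti-homo-∙ a b) refl) (conj-conj (b ⁻¹) (a ⁻¹) _)))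
          ∘ by-b⁻¹ ∘ by-a⁻¹ }
    ; ⁻¹∈  = λ (by-a , by-a⁻¹) → by-a⁻¹ , N-resp (conj-cong (sym (⁻¹-involutive _)) refl) ∘ by-a
    }

module _ {c ℓ : Level} (G : Group c ℓ) where
  open Group G
  open GroupProperties G using (ε⁻¹≈ε; \\-cong₂)
  open GroupTheory G

  shift : ∀ {p} → (ℕ → Pred Carrier p) → ℕ → Pred Carrier p
  shift F i = F (suc i)

  module _ {p} {F : ℕ → Pred Carrier p} (F-prefiltration : IsPrefiltration G F) where
    open IsPrefiltration F-prefiltration

    antitone : ∀ {m n} → m ≤ n → F n ⊆ F m
    antitone = antitone′ ∘ ≤⇒≤′
      where
      antitone′ : ∀ {m n} → m ≤′ n → F n ⊆ F m
      antitone′ ≤′-refl        = id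
      antitone′ (≤′-step m≤′n) = antitone′ m≤′n ∘ decreasing _

    shift-isPrefiltration : IsPrefiltration G (shift F)
    shift-isPrefiltration = record
      { subgroup   = subgroup ∘ suc
      ; decreasing = decreasing ∘ suc
      ; commutator = λ i j x∈ y∈ →
          antitone (s≤s (+-monoʳ-≤ i (n≤1+n j))) (commutator (suc i) (suc j) x∈ y∈)
      }

  CubeGroup : ℕ → Group c ℓ
  CubeGroup k = Pointwise.group (Cube k) G

  module C {k} = GroupTheory (CubeGroup k)

  HK-isSubgroup : ∀ {p} {F : ℕ → Pred Carrier p} {k} → IsSubgroup (CubeGroup k) (HK G F k)
  HK-isSubgroup = record { resp = resp ; ε∈ = one ; ∙∈ = mul ; ⁻¹∈ = inv }

  module _ {p} {F : ℕ → Pred Carrier p} {k : ℕ} where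
    HK-minimal : ∀ {q} {S : Pred (CubeElt G k) q} → IsSubgroup (CubeGroup k) S →
      (∀ ω₀ {g} → F (weight ω₀) g → S (face G ω₀ g)) → HK G F k ⊆ S
    HK-minimal {S = S} S-subgroup S-gen = go
      where
      open IsSubgroup S-subgroup renaming (resp to S-resp)

      go : HK G F k ⊆ S
      go (gen ω₀ g∈) = S-gen ω₀ g∈
      go one         = ε∈
      go (mul x∈ y∈) = ∙∈ (go x∈) (go y∈)
      go (inv x∈)    = ⁻¹∈ (go x∈)
      go (resp e x∈) = S-resp e (go x∈)

    HK-map : ∀ {p′ k′} {F′ : ℕ → Pred Carrier p′} {φ : CubeElt G k → CubeElt G k′} →
      GroupMorphisms.IsGroupHomomorphism (Group.rawGroup (CubeGroup k)) (Group.rawGroup (CubeGroup k′)) φ →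
      (∀ ω₀ {g} → F (weight ω₀) g → HK G F′ k′ (φ (face G ω₀ g))) →
      ∀ {x} → HK G F k x → HK G F′ k′ (φ x)
    HK-map φ-homo = HK-minimal (preimage-isSubgroup φ-homo HK-isSubgroup)

    HK-mono : ∀ {p′} {F′ : ℕ → Pred Carrier p′} → (∀ i → F i ⊆ F′ i) → HK G F k ⊆ HK G F′ k
    HK-mono F⊆F′ = HK-minimal HK-isSubgroup (λ ω₀ g∈ → gen ω₀ (F⊆F′ _ g∈))

  module _ {p} {F : ℕ → Pred Carrier p} where
    HK-zero-eval : IsPrefiltration G F → ∀ {x} → HK G F 0 x → F 0 (x [])
    HK-zero-eval F-prefiltration = HK-minimal (record
      { resp = λ x≈y → F₀.resp (x≈y [])
      ; ε∈   = F₀.ε∈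
      ; ∙∈   = F₀.∙∈
      ; ⁻¹∈  = F₀.⁻¹∈
      }) (λ { [] g∈ → g∈ })
      where module F₀ = IsSubgroup (IsPrefiltration.subgroup F-prefiltration 0)

    HK-zero-const : ∀ {g} → F 0 g → HK G F 0 (λ _ → g)
    HK-zero-const g∈ = resp (λ { [] → refl }) (gen [] g∈)

  face-⁻¹ : ∀ {k} (ω₀ : Cube k) g ω → face G ω₀ (g ⁻¹) ω ≈ face G ω₀ g ω ⁻¹
  face-⁻¹ ω₀ g ω with ω₀ ≤ᵇ ω
  ... | true  = refl
  ... | false = sym ε⁻¹≈ε

  conj-face : ∀ {k} (ω₀ ω₁ : Cube k) g h ω →
    conj (face G ω₀ g ω) (face G ω₁ h ω) ≈ face G ω₁ h ω ∙ face G (ω₁ ∨ᶜ ω₀) ([_,_] G h (g ⁻¹)) ω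
  conj-face ω₀ ω₁ g h ω rewrite ≤ᵇ-∨ᶜ ω₁ ω₀ ω with ω₀ ≤ᵇ ω | ω₁ ≤ᵇ ω
  ... | true  | true  = conj≈∙commutator g h
  ... | true  | false = trans (conj-ε g) (sym (identityʳ ε))
  ... | false | true  = trans (conj-identityˡ h) (sym (identityʳ h))
  ... | false | false = trans (conj-identityˡ ε) (sym (identityʳ ε))

  module _ {p} {F : ℕ → Pred Carrier p} (F-prefiltration : IsPrefiltration G F) where
    open IsPrefiltration F-prefiltration

    face-normalises : ∀ {k} (ω₀ : Cube k) {g} → F (weight ω₀) g →
      ∀ {u} → HK G (shift F) k u → HK G (shift F) k (C.conj (face G ω₀ g) u)
    face-normalises ω₀ {g} g∈ = HK-map (C.conj-isGroupHomomorphism (face G ω₀ g))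
      (λ ω₁ {h} h∈ → resp (λ ω → sym (conj-face ω₀ ω₁ g h ω))
        (mul (gen ω₁ h∈) (gen (ω₁ ∨ᶜ ω₀) (antitone F-prefiltration (s≤s (weight-∨ᶜ ω₁ ω₀))
          (commutator (suc (weight ω₁)) (weight ω₀) h∈ (IsSubgroup.⁻¹∈ (subgroup _) g∈))))))

    HK-normalises : ∀ {k} → HK G F k ⊆ C.Normalises (HK G (shift F) k)
    HK-normalises = HK-minimal (C.normaliser-isSubgroup resp) λ ω₀ g∈ →
        face-normalises ω₀ g∈
      , resp (λ ω → conj-cong (face-⁻¹ ω₀ _ ω) refl) ∘ face-normalises ω₀ (IsSubgroup.⁻¹∈ (subgroup _) g∈)

  lower upper : ∀ {k} → CubeElt G (suc k) → CubeElt G k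
  lower z ω = z (false ∷ ω)
  upper z ω = z (true ∷ ω)

  pair : ∀ {k} → CubeElt G k → CubeElt G k → CubeElt G (suc k)
  pair x y (false ∷ ω) = x ω
  pair x y (true  ∷ ω) = y ω

  ≈-by-faces : ∀ {k} {z z′ : CubeElt G (suc k)} →
    (∀ ω → lower z ω ≈ lower z′ ω) → (∀ ω → upper z ω ≈ upper z′ ω) → ∀ ω → z ω ≈ z′ ω
  ≈-by-faces lower≈ upper≈ (false ∷ ω) = lower≈ ω
  ≈-by-faces lower≈ upper≈ (true  ∷ ω) = upper≈ ω

  module _ {p} {F : ℕ → Pred Carrier p} {k : ℕ} where
    HK-diagonal : ∀ {x} → HK G F k x → HK G F (suc k) (pair x x)
    HK-diagonal = HK-map {φ = λ x → pair x x}
      (∙-homo⇒isGroupHomomorphism {G₁ = CubeGroup k} {G₂ = CubeGroup (suc k)}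
        (λ x≈y → ≈-by-faces x≈y x≈y)
        (λ _ _ → ≈-by-faces (λ _ → refl) (λ _ → refl)))
      (λ ω₀ g∈ → resp (≈-by-faces (λ _ → refl) (λ _ → refl)) (gen (false ∷ ω₀) g∈))

    HK-upper : ∀ {y} → HK G (shift F) k y → HK G F (suc k) (pair (λ _ → ε) y)
    HK-upper = HK-map {φ = pair (λ _ → ε)}
      (∙-homo⇒isGroupHomomorphism {G₁ = CubeGroup k} {G₂ = CubeGroup (suc k)}
        (≈-by-faces (λ _ → refl))
        (λ _ _ → ≈-by-faces (λ _ → sym (identityˡ ε)) (λ _ → refl)))
      (λ ω₀ g∈ → resp (≈-by-faces (λ _ → refl) (λ _ → refl)) (gen (true ∷ ω₀) g∈))

    HK-suc-intro : ∀ {x y} → HK G F k x → HK G (shift F) k y → HK G F (suc k) (pair x (λ ω → x ω ∙ y ω))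
    HK-suc-intro x∈ y∈ = resp (≈-by-faces (λ _ → identityʳ _) (λ _ → refl)) (mul (HK-diagonal x∈) (HK-upper y∈))

  FaceSplit : ∀ {p} → (ℕ → Pred Carrier p) → ∀ k → Pred (CubeElt G (suc k)) (c ⊔ ℓ ⊔ p)
  FaceSplit F k z = HK G F k (lower z) × HK G (shift F) k (λ ω → lower z ω \\ upper z ω)

  faceSplit-isSubgroup : ∀ {p} {F : ℕ → Pred Carrier p} → IsPrefiltration G F →
    ∀ {k} → IsSubgroup (CubeGroup (suc k)) (FaceSplit F k)
  faceSplit-isSubgroup F-prefiltration = record
    { resp = λ z≈z′ (x∈ , y∈) →
        resp (z≈z′ ∘ (false ∷_)) x∈ , resp (λ ω → \\-cong₂ (z≈z′ (false ∷ ω)) (z≈z′ (true ∷ ω))) y∈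
    ; ε∈   = one , resp (λ _ → sym (inverseˡ ε)) one
    ; ∙∈   = λ (x∈ , y∈) (x′∈ , y′∈) →
        mul x∈ x′∈
      , resp (λ ω → sym (\\-∙-conj _ _ _ _)) (mul (proj₂ (HK-normalises F-prefiltration x′∈) y∈) y′∈)
    ; ⁻¹∈  = λ (x∈ , y∈) →
        inv x∈
      , resp (λ ω → sym (\\-⁻¹-conj _ _)) (proj₁ (HK-normalises F-prefiltration x∈) (inv y∈))
    }

  HK-suc-elim : ∀ {p} {F : ℕ → Pred Carrier p} → IsPrefiltration G F → ∀ {k} → HK G F (suc k) ⊆ FaceSplit F k
  HK-suc-elim F-prefiltration = HK-minimal (faceSplit-isSubgroup F-prefiltration) λ
    { (false ∷ ω₀) g∈ → gen ω₀ g∈ , resp (λ _ → sym (inverseˡ _)) one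
    ; (true  ∷ ω₀) g∈ → one , resp (λ _ → sym (trans (∙-congʳ ε⁻¹≈ε) (identityˡ _))) (gen ω₀ g∈)
    }

  record IsFactorisation {p} (Gf Hf Kf : ℕ → Pred Carrier p) : Set (c ⊔ ℓ ⊔ p) where
    field
      Gf-prefiltration : IsPrefiltration G Gf
      Hf-prefiltration : IsPrefiltration G Hf
      Kf-prefiltration : IsPrefiltration G Kf
      Hf⊆Gf            : ∀ i → Hf i ⊆ Gf i
      Kf⊆Gf            : ∀ i → Kf i ⊆ Gf i
      Gf⊆Hf·Kf         : ∀ i → Gf i ⊆ Hf i · Kf i

  shift-isFactorisation : ∀ {p} {Gf Hf Kf : ℕ → Pred Carrier p} →
    IsFactorisation Gf Hf Kf → IsFactorisation (shift Gf) (shift Hf) (shift Kf)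
  shift-isFactorisation fact = record
    { Gf-prefiltration = shift-isPrefiltration Gf-prefiltration
    ; Hf-prefiltration = shift-isPrefiltration Hf-prefiltration
    ; Kf-prefiltration = shift-isPrefiltration Kf-prefiltration
    ; Hf⊆Gf            = Hf⊆Gf ∘ suc
    ; Kf⊆Gf            = Kf⊆Gf ∘ suc
    ; Gf⊆Hf·Kf         = Gf⊆Hf·Kf ∘ suc
    }
    where open IsFactorisation fact

  HK-factorises : ∀ {p} {Gf Hf Kf : ℕ → Pred Carrier p} → IsFactorisation Gf Hf Kf →
    ∀ k → HK G Gf k ⊆ HK G Hf k C.· HK G Kf k
  HK-factorises fact zero z∈ =
    let a , b , a∈ , b∈ , z≈ab = Gf⊆Hf·Kf 0 (HK-zero-eval Gf-prefiltration z∈)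
    in  (λ _ → a) , (λ _ → b) , HK-zero-const a∈ , HK-zero-const b∈ , λ { [] → z≈ab }
    where open IsFactorisation fact
  HK-factorises fact (suc k) z∈ =
    let x∈ , y∈                         = HK-suc-elim Gf-prefiltration z∈
        h  , κ  , h∈  , κ∈  , x≈hκ      = HK-factorises fact k x∈
        h′ , κ′ , h′∈ , κ′∈ , y≈h′κ′    = HK-factorises (shift-isFactorisation fact) k y∈
        h̃  , κ̃  , h̃∈  , κ̃∈  , κh′κ⁻¹≈h̃κ̃ = HK-factorises (shift-isFactorisation fact) k
          (proj₁ (HK-normalises Gf-prefiltration (HK-mono Kf⊆Gf κ∈)) (HK-mono (Hf⊆Gf ∘ suc) h′∈))
    in  pair h (λ ω → h ω ∙ h̃ ω) , pair κ (λ ω → κ ω ∙ (conj (κ ω ⁻¹) (κ̃ ω) ∙ κ′ ω))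
      , HK-suc-intro h∈ h̃∈ , HK-suc-intro κ∈ (mul (proj₂ (HK-normalises Kf-prefiltration κ∈) κ̃∈) κ′∈)
      , ≈-by-faces x≈hκ (λ ω → ∙-refactor (x≈hκ ω) (y≈h′κ′ ω) (κh′κ⁻¹≈h̃κ̃ ω))
    where open IsFactorisation fact

lemma6p1 : ∀ {c ℓ p} (G : Group c ℓ)
    (Gf : ℕ → Pred (Group.Carrier G) p) → IsPrefiltration G Gf →
    (H K : Pred (Group.Carrier G) p) → IsSubgroup G H → IsSubgroup G K →
    (Hf Kf : ℕ → Pred (Group.Carrier G) p) →
    IsPrefiltration G Hf → IsPrefiltration G Kf →
    (∀ i → Hf i ⊆ H) → (∀ i → Kf i ⊆ K) →
    (∀ i → Hf i ⊆ Gf i) → (∀ i → Kf i ⊆ Gf i) →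
    (∀ i {g} → Gf i g → Σ (Group.Carrier G) (λ a → Σ (Group.Carrier G) (λ b →
        Hf i a × Kf i b × Group._≈_ G g (Group._∙_ G a b)))) →
    ∀ (k : ℕ) {x : CubeElt G k} → HK G Gf k x →
    Σ (CubeElt G k) (λ y → Σ (CubeElt G k) (λ z →
        HK G Hf k y × HK G Kf k z × (∀ ω → Group._≈_ G (x ω) (Group._∙_ G (y ω) (z ω)))))
-- The ambient subgroups H and K never enter: only the prefiltrations matter.
lemma6p1 G Gf Gf-prefiltration _ _ _ _ Hf Kf Hf-prefiltration Kf-prefiltration _ _ Hf⊆Gf Kf⊆Gf Gf⊆Hf·Kf =
  HK-factorises G (record
    { Gf-prefiltration = Gf-prefiltration
    ; Hf-prefiltration = Hf-prefiltration
    ; Kf-prefiltration = Kf-prefiltration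
    ; Hf⊆Gf            = Hf⊆Gf
    ; Kf⊆Gf            = Kf⊆Gf
    ; Gf⊆Hf·Kf         = Gf⊆Hf·Kf
    })
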